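{- Let $X$ and $Y$ be graphs. Then $X$ has a strong $\mathcal{DNN}$-homomorphism to $Y$ if and only if $X$ has a weak $\mathcal{DNN}$-homomorphism to $Y$.
   Context: Graphs are finite, simple and loopless; $\sim$ denotes adjacency and $\not\sim$ non-adjacency (so $y\not\sim y$). $\mathcal{DNN}$ (doubly nonnegative cone) is the set of real positive semidefinite matrices (of any size) that are entrywise nonnegative. For graphs $X,Y$ consider matrices $H$ indexed by $V(X)\times V(Y)$ and the conditions (a) $\sum_{y,y'}H_{xy,x'y'}=1$ for all $x,x'\in V(X)$; (b) $H_{xy,x'y'}=0$ if $x\sim x'$ and $y\not\sim y'$; (c) $H_{xy,xy'}=0$ if $y\ne y'$. A strong $\mathcal{DNN}$-homomorphism from $X$ to $Y$ is an $H\in\mathcal{DNN}$ satisfying (a),(b),(c); a weak one is an $H\in\mathcal{DNN}$ satisfying (a),(b). -}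

module Defs where

open import Level using (0ℓ)
open import Data.Nat using (ℕ; zero; suc)
open import Data.Fin using (Fin; zero; suc)
open import Data.Bool using (Bool; true; false)
open import Data.Product using (_×_; _,_; ∃)
open import Relation.Nullary using (¬_)
open import Relation.Binary.PropositionalEquality using (_≡_)
open import Algebra.Structures using (IsCommutativeRing)
open import Relation.Binary.Structures using (IsTotalOrder)

-- The real numbers, axiomatised as a complete ordered field
-- (unique up to isomorphism classically).
record Reals : Set₁ where
  infixl 6 _+_
  infixl 7 _*_
  infix 4 _≤_
  field
    ℝ : Set
    _+_ _*_ : ℝ → ℝ → ℝ
    -_ : ℝ → ℝ
    0r 1r : ℝ
    _≤_ : ℝ → ℝ → Set
    isCommutativeRing : IsCommutativeRing _≡_ _+_ _*_ -_ 0r 1r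
    0≢1 : ¬ (0r ≡ 1r)
    inverse : ∀ x → ¬ (x ≡ 0r) → ∃ λ y → x * y ≡ 1r
    isTotalOrder : IsTotalOrder _≡_ _≤_
    +-monoˡ-≤ : ∀ {x y} z → x ≤ y → x + z ≤ y + z
    *-nonneg : ∀ {x y} → 0r ≤ x → 0r ≤ y → 0r ≤ x * y
    complete : (P : ℝ → Set) → ∃ P → (∃ λ b → ∀ x → P x → x ≤ b) →
               ∃ λ s → (∀ x → P x → x ≤ s) × (∀ b → (∀ x → P x → x ≤ b) → s ≤ b)

record Graph : Set where
  field
    n   : ℕ
    adj : Fin n → Fin n → Bool
    sym : ∀ x y → adj x y ≡ adj y x
    irrefl : ∀ x → adj x x ≡ false

open Graph public

module _ (R : Reals) where
  open Reals R

  sumFin : ∀ {k} → (Fin k → ℝ) → ℝ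
  sumFin {zero} f = 0r
  sumFin {suc k} f = f zero + sumFin (λ i → f (suc i))

  Matrix : Set → Set
  Matrix I = I → I → ℝ

  Idx : Graph → Graph → Set
  Idx X Y = Fin (n X) × Fin (n Y)

  sumIdx : (X Y : Graph) → (Idx X Y → ℝ) → ℝ
  sumIdx X Y f = sumFin (λ x → sumFin (λ y → f (x , y)))

  IsPSD : (X Y : Graph) → Matrix (Idx X Y) → Set
  IsPSD X Y H = (∀ i j → H i j ≡ H j i) ×
                (∀ (v : Idx X Y → ℝ) → 0r ≤ sumIdx X Y (λ i → sumIdx X Y (λ j → v i * H i j * v j)))

  IsDNN : (X Y : Graph) → Matrix (Idx X Y) → Set
  IsDNN X Y H = IsPSD X Y H × (∀ i j → 0r ≤ H i j)

  CondA : (X Y : Graph) → Matrix (Idx X Y) → Set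
  CondA X Y H = ∀ x x' → sumFin (λ y → sumFin (λ y' → H (x , y) (x' , y'))) ≡ 1r

  CondB : (X Y : Graph) → Matrix (Idx X Y) → Set
  CondB X Y H = ∀ x x' y y' → adj X x x' ≡ true → adj Y y y' ≡ false → H (x , y) (x' , y') ≡ 0r

  CondC : (X Y : Graph) → Matrix (Idx X Y) → Set
  CondC X Y H = ∀ x y y' → ¬ (y ≡ y') → H (x , y) (x , y') ≡ 0r

  StrongDNNHom : Graph → Graph → Set
  StrongDNNHom X Y = ∃ λ (H : Matrix (Idx X Y)) → IsDNN X Y H × CondA X Y H × CondB X Y H × CondC X Y H

  WeakDNNHom : Graph → Graph → Set
  WeakDNNHom X Y = ∃ λ (H : Matrix (Idx X Y)) → IsDNN X Y H × CondA X Y H × CondB X Y H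

-- A weak homomorphism H becomes a strong one once every diagonal block H[x,x] is replaced by
-- the diagonal matrix of its row sums ("mass lumping").  Conditions (a) and (b) only see row
-- sums of diagonal blocks and off-diagonal blocks, so they survive, and (c) now holds.  The
-- change is H + D − K, where K keeps the diagonal blocks of H and D their lumped versions; each
-- block of D − K is a weighted graph Laplacian, vᵀ(D − K)v = ½ Σ H_{xy,xy'} (v_{xy} − v_{xy'})²,
-- so positive semidefiniteness is preserved.
module Submission where

open import Data.Product using (_×_; _,_)
open import Data.Nat using (ℕ; suc)
open import Data.Fin as Fin using (Fin; _≟_; punchIn)
open import Data.Fin.Properties using (punchInᵢ≢i)
open import Data.Bool using (true)
open import Data.Sum using (inj₁; inj₂)
open import Function using (_∘_)
open import Relation.Nullary using (yes; no; contradiction)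
open import Relation.Binary.PropositionalEquality
  using (_≡_; _≢_; refl; sym; trans; cong; cong₂; subst; subst₂; module ≡-Reasoning)
open import Relation.Binary.Bundles using (TotalOrder)
open import Algebra.Bundles using (CommutativeRing)
import Algebra.Properties.Ring as RingProperties
import Algebra.Properties.Semiring.Sum as SemiringSum
import Algebra.Solver.Ring.NaturalCoefficients.Default as SemiringSolver
import Relation.Binary.Reasoning.PartialOrder as PosetReasoning
open import Defs hiding (sym)

module _ (R : Reals) where
  open Reals R

  commutativeRing : CommutativeRing _ _
  commutativeRing = record { isCommutativeRing = isCommutativeRing }

  totalOrder : TotalOrder _ _ _
  totalOrder = record { isTotalOrder = isTotalOrder }

  open CommutativeRing commutativeRing
    using (semiring; commutativeSemiring; +-comm; +-assoc; +-identityˡ; +-identityʳ; -‿inverseˡ; -‿inverseʳ;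
           zeroˡ; zeroʳ; distribˡ; distribʳ)
  open RingProperties (CommutativeRing.ring commutativeRing) using (-‿distribˡ-*; -‿distribʳ-*; -‿involutive)
  open TotalOrder totalOrder using (total; poset) renaming (refl to ≤-refl; trans to ≤-trans)
  open SemiringSum semiring
    using (sum; sum-cong-≗; ∑-comm; ∑-distrib-+; *-distribˡ-sum; *-distribʳ-sum; sum-remove; sum-replicate-zero)
  open SemiringSolver commutativeSemiring using (solve; _:=_; _:+_; _:*_; con)


  +-monoʳ-≤ : ∀ x {y z} → y ≤ z → x + y ≤ x + z
  +-monoʳ-≤ x {y} {z} y≤z = subst₂ _≤_ (+-comm y x) (+-comm z x) (+-monoˡ-≤ x y≤z)

  +-mono-≤ : ∀ {a b c d} → a ≤ b → c ≤ d → a + c ≤ b + d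
  +-mono-≤ {c = c} a≤b c≤d = ≤-trans (+-monoˡ-≤ c a≤b) (+-monoʳ-≤ _ c≤d)

  +-cancelʳ-≤ : ∀ {x y} z → x + z ≤ y + z → x ≤ y
  +-cancelʳ-≤ {x} {y} z x+z≤y+z = subst₂ _≤_ (cancel x) (cancel y) (+-monoˡ-≤ (- z) x+z≤y+z)
    where
    cancel : ∀ w → w + z + - z ≡ w
    cancel w = trans (+-assoc w z (- z)) (trans (cong (w +_) (-‿inverseʳ z)) (+-identityʳ w))

  x+x≤y+y⇒x≤y : ∀ {x y} → x + x ≤ y + y → x ≤ y
  x+x≤y+y⇒x≤y {x} {y} x+x≤y+y with total x y
  ... | inj₁ x≤y = x≤y
  ... | inj₂ y≤x = +-cancelʳ-≤ y (≤-trans (+-monoʳ-≤ x y≤x) x+x≤y+y)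

  0≤a∧c≤d∧b+c≡a+d⇒0≤b : ∀ {a b c d} → 0r ≤ a → c ≤ d → b + c ≡ a + d → 0r ≤ b
  0≤a∧c≤d∧b+c≡a+d⇒0≤b {a} {b} {c} {d} 0≤a c≤d b+c≡a+d =
    +-cancelʳ-≤ c (subst (0r + c ≤_) (sym b+c≡a+d) (+-mono-≤ 0≤a c≤d))

  x*0*y≡0 : ∀ x y → x * 0r * y ≡ 0r
  x*0*y≡0 x y = trans (cong (_* y) (zeroʳ x)) (zeroˡ y)

  -x*-x≡x*x : ∀ x → - x * - x ≡ x * x
  -x*-x≡x*x x = begin
    - x * - x     ≡⟨ -‿distribˡ-* x (- x) ⟨
    - (x * - x)   ≡⟨ cong -_ (-‿distribʳ-* x x) ⟨
    - (- (x * x)) ≡⟨ -‿involutive (x * x) ⟩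
    x * x         ∎
    where open ≡-Reasoning

  0≤x*x : ∀ x → 0r ≤ x * x
  0≤x*x x with total 0r x
  ... | inj₁ 0≤x = *-nonneg 0≤x 0≤x
  ... | inj₂ x≤0 = subst (0r ≤_) (-x*-x≡x*x x) (*-nonneg 0≤-x 0≤-x)
    where
    0≤-x : 0r ≤ - x
    0≤-x = subst₂ _≤_ (-‿inverseʳ x) (+-identityˡ (- x)) (+-monoˡ-≤ (- x) x≤0)

  -- 2ab ≤ a² + b², weighted by h ≥ 0: a rearrangement of h (a − b)² ≥ 0.
  x*h*y+x*h*y≤x*h*x+y*h*y : ∀ h a b → 0r ≤ h → a * h * b + a * h * b ≤ a * h * a + b * h * b
  x*h*y+x*h*y≤x*h*x+y*h*y h a b 0≤h = begin
    a * h * b + a * h * b                           ≡⟨ +-identityˡ _ ⟨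
    0r + (a * h * b + a * h * b)                    ≤⟨ +-monoˡ-≤ _ (*-nonneg 0≤h (0≤x*x (a + - b))) ⟩
    h * ((a + - b) * (a + - b)) + (a * h * b + a * h * b)
      ≡⟨ solve 4 (λ h a b u → h :* ((a :+ u) :* (a :+ u)) :+ (a :* h :* b :+ a :* h :* b)
                           := a :* h :* a :+ h :* (u :* u) :+ (h :* a :* (u :+ b) :+ h :* a :* (u :+ b)))
               refl h a b (- b) ⟩
    a * h * a + h * (- b * - b) + (h * a * (- b + b) + h * a * (- b + b))
      ≡⟨ cong₂ (λ s t → a * h * a + h * s + (h * a * t + h * a * t)) (-x*-x≡x*x b) (-‿inverseˡ b) ⟩
    a * h * a + h * (b * b) + (h * a * 0r + h * a * 0r)
      ≡⟨ solve 3 (λ h a b → a :* h :* a :+ h :* (b :* b) :+ (h :* a :* con 0 :+ h :* a :* con 0)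
                         := a :* h :* a :+ b :* h :* b)
               refl h a b ⟩
    a * h * a + b * h * b                           ∎
    where open PosetReasoning poset


  sumFin≡sum : ∀ {k} (f : Fin k → ℝ) → sumFin R f ≡ sum f
  sumFin≡sum {0} f = refl
  sumFin≡sum {suc k} f = cong (f Fin.zero +_) (sumFin≡sum (λ i → f (Fin.suc i)))

  sum-cong : ∀ {k} {f g : Fin k → ℝ} → (∀ i → f i ≡ g i) → sum f ≡ sum g
  sum-cong = sum-cong-≗

  sum-mono-≤ : ∀ {k} {f g : Fin k → ℝ} → (∀ i → f i ≤ g i) → sum f ≤ sum g
  sum-mono-≤ {0} f≤g = ≤-refl
  sum-mono-≤ {suc k} f≤g = +-mono-≤ (f≤g Fin.zero) (sum-mono-≤ (λ i → f≤g (Fin.suc i)))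

  sum-nonneg : ∀ {k} {f : Fin k → ℝ} → (∀ i → 0r ≤ f i) → 0r ≤ sum f
  sum-nonneg {k} {f} 0≤f = subst (_≤ sum f) (sum-replicate-zero k) (sum-mono-≤ 0≤f)

  sum-0 : ∀ {k} {f : Fin k → ℝ} → (∀ i → f i ≡ 0r) → sum f ≡ 0r
  sum-0 {k} f≡0 = trans (sum-cong f≡0) (sum-replicate-zero k)

  sum-δ : ∀ {k} (f : Fin k → ℝ) i → (∀ j → j ≢ i → f j ≡ 0r) → sum f ≡ f i
  sum-δ {suc k} f i vanishes = begin
    sum f                              ≡⟨ sum-remove {i = i} f ⟩
    f i + sum (λ j → f (punchIn i j))  ≡⟨ cong (f i +_) (sum-0 (λ j → vanishes _ (punchInᵢ≢i i j))) ⟩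
    f i + 0r                           ≡⟨ +-identityʳ (f i) ⟩
    f i                                ∎
    where open ≡-Reasoning

  sum-sum-distrib-+ : ∀ {m k} (f g : Fin m → Fin k → ℝ) →
                      sum (λ i → sum (λ j → f i j + g i j)) ≡ sum (λ i → sum (f i)) + sum (λ i → sum (g i))
  sum-sum-distrib-+ {m} f g = trans (sum-cong (λ i → ∑-distrib-+ (f i) (g i))) (∑-distrib-+ {m} _ _)


  form : ∀ {k} → (Fin k → Fin k → ℝ) → (Fin k → ℝ) → ℝ
  form B a = sum λ i → sum λ j → a i * B i j * a j

  diagonal : ∀ {k} → (Fin k → ℝ) → Fin k → Fin k → ℝ
  diagonal d i j with i ≟ j
  ... | yes _ = d i
  ... | no _ = 0r

  lump : ∀ {k} → (Fin k → Fin k → ℝ) → Fin k → Fin k → ℝ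
  lump B = diagonal (λ i → sum (B i))

  diagonal-≡ : ∀ {k} (d : Fin k → ℝ) i → diagonal d i i ≡ d i
  diagonal-≡ d i with i ≟ i
  ... | yes _ = refl
  ... | no i≢i = contradiction refl i≢i

  diagonal-≢ : ∀ {k} (d : Fin k → ℝ) {i j} → i ≢ j → diagonal d i j ≡ 0r
  diagonal-≢ d {i} {j} i≢j with i ≟ j
  ... | yes i≡j = contradiction i≡j i≢j
  ... | no _ = refl

  diagonal-sym : ∀ {k} (d : Fin k → ℝ) i j → diagonal d i j ≡ diagonal d j i
  diagonal-sym d i j with i ≟ j | j ≟ i
  ... | yes refl | yes _ = refl
  ... | yes refl | no i≢i = contradiction refl i≢i
  ... | no i≢i | yes refl = contradiction refl i≢i
  ... | no _ | no _ = refl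

  sum-diagonal : ∀ {k} (d : Fin k → ℝ) i → sum (diagonal d i) ≡ d i
  sum-diagonal d i = trans (sum-δ (diagonal d i) i (λ j j≢i → diagonal-≢ d (j≢i ∘ sym))) (diagonal-≡ d i)

  form-diagonal : ∀ {k} (d : Fin k → ℝ) a → form (diagonal d) a ≡ sum (λ i → a i * d i * a i)
  form-diagonal d a = sum-cong λ i → trans (sum-δ _ i (offDiagonal i)) (cong (λ z → a i * z * a i) (diagonal-≡ d i))
    where
    offDiagonal : ∀ i j → j ≢ i → a i * diagonal d i j * a j ≡ 0r
    offDiagonal i j j≢i = trans (cong (λ z → a i * z * a j) (diagonal-≢ d (j≢i ∘ sym))) (x*0*y≡0 (a i) (a j))

  -- lump B − B is the Laplacian of the weighted graph B.
  form≤form-lump : ∀ {k} (B : Fin k → Fin k → ℝ) a →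
                   (∀ i j → B i j ≡ B j i) → (∀ i j → 0r ≤ B i j) → form B a ≤ form (lump B) a
  form≤form-lump B a B-sym 0≤B = subst (form B a ≤_) (sym (form-diagonal _ a)) (x+x≤y+y⇒x≤y (begin
    form B a + form B a
      ≡⟨ sum-sum-distrib-+ cross cross ⟨
    sum (λ i → sum (λ j → cross i j + cross i j))
      ≤⟨ sum-mono-≤ (λ i → sum-mono-≤ (λ j → x*h*y+x*h*y≤x*h*x+y*h*y (B i j) (a i) (a j) (0≤B i j))) ⟩
    sum (λ i → sum (λ j → leftSquare i j + a j * B i j * a j))
      ≡⟨ sum-sum-distrib-+ leftSquare (λ i j → a j * B i j * a j) ⟩
    sum (λ i → sum (leftSquare i)) + sum (λ i → sum (λ j → a j * B i j * a j))
      ≡⟨ cong (sum (λ i → sum (leftSquare i)) +_) swap ⟩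
    sum (λ i → sum (leftSquare i)) + sum (λ i → sum (leftSquare i))
      ≡⟨ cong₂ _+_ rowSums rowSums ⟩
    S + S ∎))
    where
    open PosetReasoning poset
    cross leftSquare : _ → _ → ℝ
    cross i j = a i * B i j * a j
    leftSquare i j = a i * B i j * a i
    S : ℝ
    S = sum (λ i → a i * sum (B i) * a i)
    swap : sum (λ i → sum (λ j → a j * B i j * a j)) ≡ sum (λ i → sum (leftSquare i))
    swap = trans (∑-comm (λ i j → a j * B i j * a j))
                 (sum-cong λ j → sum-cong λ i → cong (λ z → a j * z * a j) (B-sym i j))
    rowSums : sum (λ i → sum (leftSquare i)) ≡ S
    rowSums = sum-cong λ i → begin-equality
      sum (leftSquare i)               ≡⟨ *-distribʳ-sum (a i) (λ j → a i * B i j) ⟨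
      sum (λ j → a i * B i j) * a i    ≡⟨ cong (_* a i) (*-distribˡ-sum (a i) (B i)) ⟨
      a i * sum (B i) * a i            ∎


  module _ {m k : ℕ} where

    ∑∑ : (Fin m × Fin k → ℝ) → ℝ
    ∑∑ f = sum λ x → sum λ y → f (x , y)

    ∑∑-cong : {f g : Fin m × Fin k → ℝ} → (∀ i → f i ≡ g i) → ∑∑ f ≡ ∑∑ g
    ∑∑-cong f≡g = sum-cong λ x → sum-cong λ y → f≡g (x , y)

    ∑∑-distrib-+ : (f g : Fin m × Fin k → ℝ) → ∑∑ (λ i → f i + g i) ≡ ∑∑ f + ∑∑ g
    ∑∑-distrib-+ f g = sum-sum-distrib-+ (λ x y → f (x , y)) (λ x y → g (x , y))

    quadraticForm : (Fin m × Fin k → Fin m × Fin k → ℝ) → (Fin m × Fin k → ℝ) → ℝ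
    quadraticForm M v = ∑∑ λ i → ∑∑ λ j → v i * M i j * v j

    quadraticForm-cong : ∀ {M N} v → (∀ i j → M i j ≡ N i j) → quadraticForm M v ≡ quadraticForm N v
    quadraticForm-cong v M≡N = ∑∑-cong λ i → ∑∑-cong λ j → cong (λ z → v i * z * v j) (M≡N i j)

    quadraticForm-+ : ∀ M N v →
                      quadraticForm (λ i j → M i j + N i j) v ≡ quadraticForm M v + quadraticForm N v
    quadraticForm-+ M N v = begin
      ∑∑ (λ i → ∑∑ λ j → v i * (M i j + N i j) * v j)
        ≡⟨ ∑∑-cong (λ i → ∑∑-cong λ j → distrib i j) ⟩
      ∑∑ (λ i → ∑∑ λ j → v i * M i j * v j + v i * N i j * v j)
        ≡⟨ ∑∑-cong (λ i → ∑∑-distrib-+ _ _) ⟩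
      ∑∑ (λ i → (∑∑ λ j → v i * M i j * v j) + (∑∑ λ j → v i * N i j * v j))
        ≡⟨ ∑∑-distrib-+ _ _ ⟩
      quadraticForm M v + quadraticForm N v ∎
      where
      open ≡-Reasoning
      distrib : ∀ i j → v i * (M i j + N i j) * v j ≡ v i * M i j * v j + v i * N i j * v j
      distrib i j = trans (cong (_* v j) (distribˡ (v i) (M i j) (N i j))) (distribʳ (v j) _ _)

    block : (Fin m × Fin k → Fin m × Fin k → ℝ) → Fin m → Fin m → Fin k → Fin k → ℝ
    block M x x' y y' = M (x , y) (x' , y')

    diagonalBlock : (Fin m × Fin k → Fin m × Fin k → ℝ) → Fin m → Fin k → Fin k → ℝ
    diagonalBlock M x = block M x x

    onDiagonalBlocks : (Fin m → Fin k → Fin k → ℝ) → Fin m × Fin k → Fin m × Fin k → ℝ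
    onDiagonalBlocks B (x , y) (x' , y') with x ≟ x'
    ... | yes _ = B x y y'
    ... | no _ = 0r

    onDiagonalBlocks-≡ : ∀ B x y y' → onDiagonalBlocks B (x , y) (x , y') ≡ B x y y'
    onDiagonalBlocks-≡ B x y y' with x ≟ x
    ... | yes _ = refl
    ... | no x≢x = contradiction refl x≢x

    onDiagonalBlocks-≢ : ∀ B {x x'} y y' → x ≢ x' → onDiagonalBlocks B (x , y) (x' , y') ≡ 0r
    onDiagonalBlocks-≢ B {x} {x'} y y' x≢x' with x ≟ x'
    ... | yes x≡x' = contradiction x≡x' x≢x'
    ... | no _ = refl

    quadraticForm-onDiagonalBlocks : ∀ B v →
      quadraticForm (onDiagonalBlocks B) v ≡ sum (λ x → form (B x) (λ y → v (x , y)))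
    quadraticForm-onDiagonalBlocks B v = sum-cong λ x → begin
      sum (λ y → sum λ x' → sum λ y' → term x y x' y')  ≡⟨ ∑-comm (λ y x' → sum λ y' → term x y x' y') ⟩
      sum (λ x' → sum λ y → sum λ y' → term x y x' y')  ≡⟨ sum-δ _ x (offBlock x) ⟩
      sum (λ y → sum λ y' → term x y x y')              ≡⟨ sum-cong (λ y → sum-cong λ y' → onBlock x y y') ⟩
      form (B x) (λ y → v (x , y))                      ∎
      where
      open ≡-Reasoning
      term : Fin m → Fin k → Fin m → Fin k → ℝ
      term x y x' y' = v (x , y) * onDiagonalBlocks B (x , y) (x' , y') * v (x' , y')
      offBlock : ∀ x x' → x' ≢ x → sum (λ y → sum λ y' → term x y x' y') ≡ 0r
      offBlock x x' x'≢x = sum-0 λ y → sum-0 λ y' →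
        trans (cong (λ z → v (x , y) * z * v (x' , y')) (onDiagonalBlocks-≢ B y y' (x'≢x ∘ sym)))
              (x*0*y≡0 _ _)
      onBlock : ∀ x y y' → term x y x y' ≡ v (x , y) * B x y y' * v (x , y')
      onBlock x y y' = cong (λ z → v (x , y) * z * v (x , y')) (onDiagonalBlocks-≡ B x y y')

    lumpDiagonalBlocks : (Fin m × Fin k → Fin m × Fin k → ℝ) → Fin m × Fin k → Fin m × Fin k → ℝ
    lumpDiagonalBlocks M (x , y) (x' , y') with x ≟ x'
    ... | yes _ = lump (diagonalBlock M x) y y'
    ... | no _ = M (x , y) (x' , y')

    lumpDiagonalBlocks-≡ : ∀ M x y y' → lumpDiagonalBlocks M (x , y) (x , y') ≡ lump (diagonalBlock M x) y y'
    lumpDiagonalBlocks-≡ M x y y' with x ≟ x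
    ... | yes _ = refl
    ... | no x≢x = contradiction refl x≢x

    lumpDiagonalBlocks-≢ : ∀ M {x x'} y y' → x ≢ x' →
                           lumpDiagonalBlocks M (x , y) (x' , y') ≡ M (x , y) (x' , y')
    lumpDiagonalBlocks-≢ M {x} {x'} y y' x≢x' with x ≟ x'
    ... | yes x≡x' = contradiction x≡x' x≢x'
    ... | no _ = refl

    lumpDiagonalBlocks-sym : ∀ M → (∀ i j → M i j ≡ M j i) →
                             ∀ i j → lumpDiagonalBlocks M i j ≡ lumpDiagonalBlocks M j i
    lumpDiagonalBlocks-sym M M-sym (x , y) (x' , y') with x ≟ x' | x' ≟ x
    ... | yes refl | yes _ = diagonal-sym _ y y'
    ... | yes refl | no x≢x = contradiction refl x≢x
    ... | no x≢x | yes refl = contradiction refl x≢x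
    ... | no _ | no _ = M-sym (x , y) (x' , y')

    lumpDiagonalBlocks-nonneg : ∀ M → (∀ i j → 0r ≤ M i j) → ∀ i j → 0r ≤ lumpDiagonalBlocks M i j
    lumpDiagonalBlocks-nonneg M 0≤M (x , y) (x' , y') with x ≟ x'
    ... | no _ = 0≤M (x , y) (x' , y')
    ... | yes _ with y ≟ y'
    ...   | yes _ = sum-nonneg (λ y'' → 0≤M (x , y) (x , y''))
    ...   | no _ = ≤-refl

    sum-block-lumpDiagonalBlocks : ∀ M x x' →
      sum (λ y → sum (block (lumpDiagonalBlocks M) x x' y)) ≡ sum (λ y → sum (block M x x' y))
    sum-block-lumpDiagonalBlocks M x x' with x ≟ x'
    ... | yes refl = sum-cong λ y → sum-diagonal (λ y → sum (diagonalBlock M x y)) y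
    ... | no _ = refl

    lumpDiagonalBlocks-+-onDiagonalBlocks : ∀ M i j →
      lumpDiagonalBlocks M i j + onDiagonalBlocks (diagonalBlock M) i j
      ≡ M i j + onDiagonalBlocks (lump ∘ diagonalBlock M) i j
    lumpDiagonalBlocks-+-onDiagonalBlocks M (x , y) (x' , y') with x ≟ x'
    ... | yes refl = +-comm _ _
    ... | no _ = refl

    quadraticForm-lumpDiagonalBlocks-nonneg : ∀ M v → (∀ i j → M i j ≡ M j i) → (∀ i j → 0r ≤ M i j) →
      0r ≤ quadraticForm M v → 0r ≤ quadraticForm (lumpDiagonalBlocks M) v
    quadraticForm-lumpDiagonalBlocks-nonneg M v M-sym 0≤M 0≤vMv =
      0≤a∧c≤d∧b+c≡a+d⇒0≤b 0≤vMv blocks≤lumpedBlocks decomposition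
      where
      blocks≤lumpedBlocks : quadraticForm (onDiagonalBlocks (diagonalBlock M)) v
                          ≤ quadraticForm (onDiagonalBlocks (lump ∘ diagonalBlock M)) v
      blocks≤lumpedBlocks =
        subst₂ _≤_ (sym (quadraticForm-onDiagonalBlocks _ v)) (sym (quadraticForm-onDiagonalBlocks _ v))
          (sum-mono-≤ λ x → form≤form-lump (diagonalBlock M x) (λ y → v (x , y))
                                 (λ y y' → M-sym (x , y) (x , y')) (λ y y' → 0≤M (x , y) (x , y')))
      decomposition : quadraticForm (lumpDiagonalBlocks M) v + quadraticForm (onDiagonalBlocks (diagonalBlock M)) v
                    ≡ quadraticForm M v + quadraticForm (onDiagonalBlocks (lump ∘ diagonalBlock M)) v
      decomposition = begin
        quadraticForm (lumpDiagonalBlocks M) v + quadraticForm (onDiagonalBlocks (diagonalBlock M)) v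
          ≡⟨ quadraticForm-+ _ _ v ⟨
        quadraticForm (λ i j → lumpDiagonalBlocks M i j + onDiagonalBlocks (diagonalBlock M) i j) v
          ≡⟨ quadraticForm-cong v (lumpDiagonalBlocks-+-onDiagonalBlocks M) ⟩
        quadraticForm (λ i j → M i j + onDiagonalBlocks (lump ∘ diagonalBlock M) i j) v
          ≡⟨ quadraticForm-+ _ _ v ⟩
        quadraticForm M v + quadraticForm (onDiagonalBlocks (lump ∘ diagonalBlock M)) v ∎
        where open ≡-Reasoning


  sumFin²≡sum² : ∀ {m k} (f : Fin m → Fin k → ℝ) →
                 sumFin R (λ x → sumFin R (f x)) ≡ sum (λ x → sum (f x))
  sumFin²≡sum² f = trans (sumFin≡sum λ x → sumFin R (f x)) (sum-cong λ x → sumFin≡sum (f x))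

  module _ (X Y : Graph) where

    sumIdx-quadraticForm : ∀ M v →
      sumIdx R X Y (λ i → sumIdx R X Y (λ j → v i * M i j * v j)) ≡ quadraticForm M v
    sumIdx-quadraticForm M v =
      trans (sumFin²≡sum² λ x y → sumIdx R X Y λ j → v (x , y) * M (x , y) j * v j)
            (∑∑-cong λ i → sumFin²≡sum² λ x y → v i * M i (x , y) * v (x , y))

    adjacent⇒≢ : ∀ {x x'} → adj X x x' ≡ true → x ≢ x'
    adjacent⇒≢ {x} x∼x' refl with () ← trans (sym x∼x') (irrefl X x)

    weak⇒strong : WeakDNNHom R X Y → StrongDNNHom R X Y
    weak⇒strong (H , ((H-sym , H-psd) , 0≤H) , condA , condB) =
      L , ((lumpDiagonalBlocks-sym H H-sym , L-psd) , lumpDiagonalBlocks-nonneg H 0≤H) , L-condA , L-condB , L-condC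
      where
      L : Matrix R (Idx R X Y)
      L = lumpDiagonalBlocks H

      L-psd : ∀ v → 0r ≤ sumIdx R X Y (λ i → sumIdx R X Y (λ j → v i * L i j * v j))
      L-psd v = subst (0r ≤_) (sym (sumIdx-quadraticForm L v))
        (quadraticForm-lumpDiagonalBlocks-nonneg H v H-sym 0≤H (subst (0r ≤_) (sumIdx-quadraticForm H v) (H-psd v)))

      L-condA : CondA R X Y L
      L-condA x x' = begin
        sumFin R (λ y → sumFin R (block L x x' y))  ≡⟨ sumFin²≡sum² (block L x x') ⟩
        sum (λ y → sum (block L x x' y))            ≡⟨ sum-block-lumpDiagonalBlocks H x x' ⟩
        sum (λ y → sum (block H x x' y))            ≡⟨ sumFin²≡sum² (block H x x') ⟨
        sumFin R (λ y → sumFin R (block H x x' y))  ≡⟨ condA x x' ⟩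
        1r                                          ∎
        where open ≡-Reasoning

      L-condB : CondB R X Y L
      L-condB x x' y y' x∼x' y≁y' =
        trans (lumpDiagonalBlocks-≢ H y y' (adjacent⇒≢ x∼x')) (condB x x' y y' x∼x' y≁y')

      L-condC : CondC R X Y L
      L-condC x y y' y≢y' = trans (lumpDiagonalBlocks-≡ H x y y') (diagonal-≢ _ y≢y')

mainTheorem3 : (R : Reals) (X Y : Graph) → (StrongDNNHom R X Y → WeakDNNHom R X Y) × (WeakDNNHom R X Y → StrongDNNHom R X Y)
mainTheorem3 R X Y = (λ (H , dnn , condA , condB , _) → H , dnn , condA , condB) , weak⇒strong R X Y
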